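{- If $G$ is a finite simple graph with at least two vertices that has a dominating vertex (a vertex adjacent to all other vertices), then $\pi^{c}(G)=2$.
   Context: A configuration of cops on $G$ is a function $C:V(G)\to\mathbb{Z}_{\ge 0}$ of size $\sum_v C(v)$. A pebbling step from a vertex $u$ with at least two cops to an adjacent vertex $v$ removes two cops from $u$ and adds one cop to $v$. In the cops and robbers pebbling game, cops are placed according to $C$, then a robber chooses a starting vertex; thereafter, in each turn the cops make pebbling steps, after which the robber either moves to an adjacent vertex or stays put. The robber is captured when he occupies a vertex holding at least one cop. The cop pebbling number $\pi^{c}(G)$ is the minimum $m$ such that some configuration of size $m$ allows the cops to capture the robber regardless of how he starts and moves. -}

module Defs where

open import Data.Nat using (ℕ; zero; suc; _+_; _≤_)
open import Data.Fin using (Fin)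
open import Data.Vec using (sum; tabulate)
open import Data.Product using (Σ; ∃; _×_; _,_)
open import Data.Sum using (_⊎_)
open import Relation.Nullary using (¬_)
open import Relation.Binary.PropositionalEquality using (_≡_; _≢_)
open import Relation.Binary.Construct.Closure.ReflexiveTransitive using (Star)

record SimpleGraph (n : ℕ) : Set₁ where
  field
    Adj     : Fin n → Fin n → Set
    symm    : ∀ {u v} → Adj u v → Adj v u
    irrefl  : ∀ {u} → ¬ Adj u u
open SimpleGraph public

Config : ℕ → Set
Config n = Fin n → ℕ

size : ∀ {n} → Config n → ℕ
size {n} C = sum (tabulate C)

module _ {n : ℕ} (G : SimpleGraph n) where

  PebblingStep : Config n → Config n → Set
  PebblingStep C C′ =
    Σ (Fin n) λ u → Σ (Fin n) λ v →
      Adj G u v × (C′ u + 2 ≡ C u) × (C′ v ≡ suc (C v)) ×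
      (∀ w → w ≢ u → w ≢ v → C′ w ≡ C w)

  CopTurn : Config n → Config n → Set
  CopTurn = Star PebblingStep

  RobberMove : Fin n → Fin n → Set
  RobberMove r r′ = r′ ≡ r ⊎ Adj G r r′

  -- CopsWin C r : with configuration C and the robber on r (cops to move,
  -- or robber just placed/moved), the cops can force capture in finitely
  -- many turns.
  data CopsWin : Config n → Fin n → Set where
    captured : ∀ {C r} → 1 ≤ C r → CopsWin C r
    turn     : ∀ {C C′ r} → CopTurn C C′ →
               (1 ≤ C′ r ⊎ (∀ r′ → RobberMove r r′ → CopsWin C′ r′)) →
               CopsWin C r

  Capturing : Config n → Set
  Capturing C = ∀ r → CopsWin C r

  CopPebblingNumberIs : ℕ → Set
  CopPebblingNumberIs m =
    (Σ (Config n) λ C → size C ≡ m × Capturing C) ×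
    (∀ C → Capturing C → m ≤ size C)

Dominating : ∀ {n} → SimpleGraph n → Fin n → Set
Dominating {n} G u = ∀ v → v ≢ u → Adj G u v

-- Two cops on a dominating vertex u catch the robber at once: either he
-- stands on u, or one pebbling step moves a cop onto his vertex. Conversely,
-- a configuration of size at most one leaves some vertex empty (there are at
-- least two vertices) and admits no pebbling step at all, so a robber who
-- starts on an empty vertex and never moves is never captured.
module Submission where

open import Defs
open import Data.Nat using (ℕ; zero; suc; _+_; _≤_; _<_; z≤n; s≤s; _≤?_)
open import Data.Nat.Properties
  using (≤-pred; ≤-reflexive; ≤-trans; <-≤-trans; m≤m+n; m≤n+m; +-mono-≤; +-identityʳ;
         ≰⇒>; <⇒≱; n<1⇒n≡0)
open import Data.Fin using (Fin; zero; suc)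
open import Data.Fin.Properties using (_≟_; ¬∀⟶∃¬)
open import Data.Product using (∃; _,_)
open import Data.Sum using (inj₁; inj₂)
open import Relation.Nullary using (¬_; yes; no; contradiction)
open import Relation.Binary.PropositionalEquality
  using (_≡_; _≢_; refl; sym; trans; cong; subst)
open import Relation.Binary.Construct.Closure.ReflexiveTransitive using (ε; _◅_)

pile : ∀ {n} → Fin n → ℕ → Config n
pile zero    k zero    = k
pile zero    k (suc w) = 0
pile (suc u) k zero    = 0
pile (suc u) k (suc w) = pile u k w

pile-self : ∀ {n} (u : Fin n) k → pile u k u ≡ k
pile-self zero    k = refl
pile-self (suc u) k = pile-self u k

pile-other : ∀ {n} {u w : Fin n} k → w ≢ u → pile u k w ≡ 0
pile-other {u = zero}  {zero}  k w≢u = contradiction refl w≢u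
pile-other {u = zero}  {suc w} k w≢u = refl
pile-other {u = suc u} {zero}  k w≢u = refl
pile-other {u = suc u} {suc w} k w≢u = pile-other k (λ w≡u → w≢u (cong suc w≡u))

size-empty : ∀ n → size {n} (λ _ → 0) ≡ 0
size-empty zero    = refl
size-empty (suc n) = size-empty n

size-pile : ∀ {n} (u : Fin n) k → size (pile u k) ≡ k
size-pile {suc n} zero k = trans (cong (k +_) (size-empty n)) (+-identityʳ k)
size-pile (suc u) k = size-pile u k

lookup≤size : ∀ {n} (C : Config n) w → C w ≤ size C
lookup≤size C zero    = m≤m+n (C zero) _
lookup≤size C (suc w) = ≤-trans (lookup≤size (λ v → C (suc v)) w) (m≤n+m _ (C zero))

occupied⇒n≤size : ∀ {n} (C : Config n) → (∀ w → 1 ≤ C w) → n ≤ size C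
occupied⇒n≤size {zero}  C occ = z≤n
occupied⇒n≤size {suc n} C occ =
  +-mono-≤ (occ zero) (occupied⇒n≤size (λ v → C (suc v)) (λ v → occ (suc v)))

size<n⇒empty-vertex : ∀ {n} (C : Config n) → size C < n → ∃ λ r → C r ≡ 0
size<n⇒empty-vertex {n} C size<n with ¬∀⟶∃¬ n (λ w → 1 ≤ C w) (λ w → 1 ≤? C w) all-occupied
  where
  all-occupied : ¬ (∀ w → 1 ≤ C w)
  all-occupied occ = <⇒≱ size<n (occupied⇒n≤size C occ)
... | r , unoccupied = r , n<1⇒n≡0 (≰⇒> unoccupied)

module _ {n : ℕ} (G : SimpleGraph n) where

  Stuck : Config n → Set
  Stuck C = ∀ {C′} → ¬ PebblingStep G C C′

  at-most-one⇒stuck : ∀ {C} → (∀ w → C w ≤ 1) → Stuck C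
  at-most-one⇒stuck {C} ≤1 {C′} (u , _ , _ , C′u+2≡Cu , _) with
    ≤-trans (m≤n+m 2 (C′ u)) (≤-trans (≤-reflexive C′u+2≡Cu) (≤1 u))
  ... | s≤s ()

  stuck-empty⇒escape : ∀ {C r} → Stuck C → C r ≡ 0 → ¬ CopsWin G C r
  stuck-empty⇒escape stuck Cr≡0 (captured 1≤Cr) = contradiction (subst (1 ≤_) Cr≡0 1≤Cr) λ ()
  stuck-empty⇒escape stuck Cr≡0 (turn (step ◅ _) _) = stuck step
  stuck-empty⇒escape stuck Cr≡0 (turn ε (inj₁ 1≤Cr)) = contradiction (subst (1 ≤_) Cr≡0 1≤Cr) λ ()
  stuck-empty⇒escape stuck Cr≡0 (turn ε (inj₂ next)) = stuck-empty⇒escape stuck Cr≡0 (next _ (inj₁ refl))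

  capturing⇒2≤size : 2 ≤ n → ∀ C → Capturing G C → 2 ≤ size C
  capturing⇒2≤size 2≤n C capturing with 2 ≤? size C
  ... | yes 2≤size = 2≤size
  ... | no 2≰size with size<n⇒empty-vertex C (<-≤-trans (≰⇒> 2≰size) 2≤n)
  ...   | r , Cr≡0 = contradiction (capturing r) (stuck-empty⇒escape stuck Cr≡0)
    where
    stuck : Stuck C
    stuck = at-most-one⇒stuck (λ w → ≤-trans (lookup≤size C w) (≤-pred (≰⇒> 2≰size)))

  pile-step : ∀ {u v} → Adj G u v → PebblingStep G (pile u 2) (pile v 1)
  pile-step {u} {v} uv =
      u , v , uv
    , trans (cong (_+ 2) (pile-other 1 u≢v)) (sym (pile-self u 2))
    , trans (pile-self v 1) (cong suc (sym (pile-other 2 v≢u)))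
    , λ w w≢u w≢v → trans (pile-other 1 w≢v) (sym (pile-other 2 w≢u))
    where
    u≢v : u ≢ v
    u≢v refl = irrefl G uv
    v≢u : v ≢ u
    v≢u v≡u = u≢v (sym v≡u)

  dominating-pile-capturing : ∀ {u} → Dominating G u → Capturing G (pile u 2)
  dominating-pile-capturing {u} dom r with r ≟ u
  ... | yes refl = captured (≤-trans (s≤s z≤n) (≤-reflexive (sym (pile-self u 2))))
  ... | no r≢u   = turn (pile-step (dom r r≢u) ◅ ε) (inj₁ (≤-reflexive (sym (pile-self r 1))))

corollary5 : (n : ℕ) (G : SimpleGraph n) → 2 ≤ n →
    ∃ (λ u → Dominating G u) → CopPebblingNumberIs G 2
corollary5 n G 2≤n (u , dom) =
    (pile u 2 , size-pile u 2 , dominating-pile-capturing G dom)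
  , capturing⇒2≤size G 2≤n
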